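{- Let $G=(V,E)$ be a simple graph and $S\subseteq V$. Suppose that for some $i\ge 0$, a subset $S'$ of $\mathcal{P}^i(S)$ is a zero forcing set of the subgraph of $G$ induced by $(V\setminus\mathcal{P}^i(S))\cup S'$. Then $S$ is a power dominating set of $G$.
   Context: For $v\in V$, $N[v]$ is the closed neighborhood; for $S\subseteq V$, $N[S]=\bigcup_{v\in S}N[v]$. Define $\mathcal{P}^0(S)=N[S]$, $\mathcal{P}^{i+1}(S)=\mathcal{P}^i(S)\cup\{w : \{w\}=N[v]\setminus\mathcal{P}^i(S)\text{ for some } v\in\mathcal{P}^i(S)\}$, with eventual value $\mathcal{P}^\infty(S)$; $S$ is a power dominating set if $\mathcal{P}^\infty(S)=V$. In a graph $H$, for $Z\subseteq V(H)$ let $\mathcal{Q}^0(Z)=Z$ and $\mathcal{Q}^{j+1}(Z)=\mathcal{Q}^j(Z)\cup\bigcup\{N_H[v]: v\in\mathcal{Q}^j(Z),\ |N_H[v]\setminus\mathcal{Q}^j(Z)|=1\}$; $Z$ is a zero forcing set of $H$ if this process eventually yields $V(H)$. -}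

module Defs where

open import Data.Nat using (ℕ; zero; suc)
open import Data.Fin using (Fin)
open import Data.Bool using (Bool; true; false)
open import Data.Product using (Σ; ∃; _×_)
open import Data.Sum using (_⊎_)
open import Data.Empty using (⊥)
open import Relation.Nullary using (¬_)
open import Relation.Binary.PropositionalEquality using (_≡_)

record Graph (n : ℕ) : Set where
  field
    adj    : Fin n → Fin n → Bool
    sym    : ∀ u v → adj u v ≡ adj v u
    irrefl : ∀ v → adj v v ≡ false
open Graph public

VSet : ℕ → Set₁
VSet n = Fin n → Set

_⊆_ : ∀ {n} → VSet n → VSet n → Set
A ⊆ B = ∀ v → A v → B v

-- closed neighbourhood:  Nc G v w  means  w ∈ N[v]
Nc : ∀ {n} (G : Graph n) → Fin n → Fin n → Set
Nc G v = λ w → (w ≡ v) ⊎ (adj G v w ≡ true)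

-- {w} = A \ B  (A minus B is exactly the singleton {w})
Only : ∀ {n} → VSet n → VSet n → Fin n → Set
Only A B w = A w × ¬ B w × (∀ u → A u → ¬ B u → u ≡ w)

𝒫 : ∀ {n} (G : Graph n) → VSet n → ℕ → VSet n
𝒫 G S zero w = ∃ λ v → S v × Nc G v w
𝒫 G S (suc i) w =
  𝒫 G S i w ⊎ (∃ λ v → 𝒫 G S i v × Only (Nc G v) (𝒫 G S i) w)

-- 𝒫^∞(S) is the eventual value = union over all i; S is power dominating
-- iff 𝒫^∞(S) = V.
PowerDominating : ∀ {n} → Graph n → VSet n → Set
PowerDominating G S = ∀ w → ∃ λ i → 𝒫 G S i w

-- Induced subgraph H = G[W] for W ⊆ V: closed neighbourhood N_H[v] = N[v] ∩ W.
NH : ∀ {n} (G : Graph n) (W : VSet n) → Fin n → Fin n → Set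
NH G W v = λ w → W w × Nc G v w

𝒬 : ∀ {n} (G : Graph n) (W : VSet n) → VSet n → ℕ → VSet n
𝒬 G W Z zero w = Z w
𝒬 G W Z (suc j) w =
  𝒬 G W Z j w ⊎
  (∃ λ v → 𝒬 G W Z j v
         × (∃ λ u → Only (NH G W v) (𝒬 G W Z j) u)
         × NH G W v w)

ZeroForcingInduced : ∀ {n} → Graph n → VSet n → VSet n → Set
ZeroForcingInduced G W Z = Z ⊆ W × (∀ w → W w → ∃ λ j → 𝒬 G W Z j w)

CompUnion : ∀ {n} → VSet n → VSet n → VSet n
CompUnion A B w = ¬ A w ⊎ B w

-- Subsets of V given by characteristic functions (decidable membership).
BSet : ℕ → Set
BSet n = Fin n → Bool

⟦_⟧ : ∀ {n} → BSet n → VSet n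
⟦ A ⟧ v = A v ≡ true

module Submission where

-- Write W = (V ∖ 𝒫ⁱ(S)) ∪ S′ and H = G[W].  We show that the
-- zero forcing process in H is simulated by the power domination process
-- started i steps late:  𝒬ʲ(S′) ⊆ 𝒫ʲ⁺ⁱ(S)  for every j.  A forcing step in H
-- is performed by a vertex v whose H-neighbourhood contains exactly one
-- unforced vertex u; every neighbour of v in G outside 𝒫ʲ⁺ⁱ(S) lies in W
-- (it is not in 𝒫ⁱ(S), by monotonicity) and is unforced (by induction), so
-- it must be u.  Hence v sees at most one unobserved vertex and the
-- propagation rule observes all of N[v] one step later.
-- Since 𝒫 is decidable (the graph is finite), each vertex either lies in
-- 𝒫ⁱ(S) already or lies in W, where zero forcing reaches it.

open import Defs
open import Data.Nat using (ℕ; zero; suc; _+_)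
open import Data.Fin using (Fin; _≟_)
open import Data.Fin.Properties using (any?; all?)
open import Data.Bool using (true)
open import Data.Bool.Properties using () renaming (_≟_ to _≟ᵇ_)
open import Data.Product using (_,_)
open import Data.Sum using (inj₁; inj₂)
open import Relation.Nullary using (¬_; yes; no)
open import Relation.Nullary.Decidable.Core using (_×-dec_; _⊎-dec_; _→-dec_; ¬?)
open import Relation.Unary using (Decidable)
open import Relation.Binary.PropositionalEquality using (_≡_; trans) renaming (sym to ≡-sym)

Nc? : ∀ {n} (G : Graph n) (v : Fin n) → Decidable (Nc G v)
Nc? G v w = (w ≟ v) ⊎-dec (adj G v w ≟ᵇ true)

⟦⟧? : ∀ {n} (A : BSet n) → Decidable ⟦ A ⟧
⟦⟧? A v = A v ≟ᵇ true

Only? : ∀ {n} {A B : VSet n} → Decidable A → Decidable B → Decidable (Only A B)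
Only? A? B? w =
  A? w ×-dec ¬? (B? w) ×-dec all? (λ u → A? u →-dec (¬? (B? u) →-dec (u ≟ w)))

module _ {n} (G : Graph n) (S : VSet n) where

  𝒫? : Decidable S → ∀ k → Decidable (𝒫 G S k)
  𝒫? S? zero    w = any? (λ v → S? v ×-dec Nc? G v w)
  𝒫? S? (suc k) w =
    𝒫? S? k w ⊎-dec any? (λ v → 𝒫? S? k v ×-dec Only? (Nc? G v) (𝒫? S? k) w)

  𝒫-mono : ∀ k m → 𝒫 G S k ⊆ 𝒫 G S (m + k)
  𝒫-mono k zero    w p = p
  𝒫-mono k (suc m) w p = inj₁ (𝒫-mono k m w p)

  propagate : Decidable S → ∀ k v u → 𝒫 G S k v
            → (∀ x → Nc G v x → ¬ 𝒫 G S k x → x ≡ u)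
            → Nc G v ⊆ 𝒫 G S (suc k)
  propagate S? k v u pv onlyU w ncw with 𝒫? S? k w
  ... | yes pw = inj₁ pw
  ... | no ¬pw = inj₂ (v , pv , ncw , ¬pw , onlyW)
    where
    onlyW : ∀ x → Nc G v x → ¬ 𝒫 G S k x → x ≡ w
    onlyW x ncx ¬px = trans (onlyU x ncx ¬px) (≡-sym (onlyU w ncw ¬pw))

  simulate : Decidable S → ∀ i (S′ : VSet n) → S′ ⊆ 𝒫 G S i
           → ∀ j → 𝒬 G (CompUnion (𝒫 G S i) S′) S′ j ⊆ 𝒫 G S (j + i)
  simulate S? i S′ S′⊆𝒫 zero    w q = S′⊆𝒫 w q
  simulate S? i S′ S′⊆𝒫 (suc j) w (inj₁ q) = inj₁ (simulate S? i S′ S′⊆𝒫 j w q)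
  simulate S? i S′ S′⊆𝒫 (suc j) w (inj₂ (v , qv , (u , _ , _ , onlyU) , _ , ncw)) =
    propagate S? (j + i) v u (simulate S? i S′ S′⊆𝒫 j v qv) onlyUnobserved w ncw
    where
    -- An unobserved neighbour x is outside 𝒫ⁱ(S), hence in the induced
    -- subgraph, and not yet forced; so it is the unique unforced vertex u.
    onlyUnobserved : ∀ x → Nc G v x → ¬ 𝒫 G S (j + i) x → x ≡ u
    onlyUnobserved x ncx ¬px =
      onlyU x (inj₁ (λ px → ¬px (𝒫-mono i j x px)) , ncx)
              (λ qx → ¬px (simulate S? i S′ S′⊆𝒫 j x qx))

lemma5 : ∀ {n} (G : Graph n) (S : BSet n) (i : ℕ) (S′ : BSet n)
    → ⟦ S′ ⟧ ⊆ 𝒫 G ⟦ S ⟧ i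
    → ZeroForcingInduced G (CompUnion (𝒫 G ⟦ S ⟧ i) ⟦ S′ ⟧) ⟦ S′ ⟧
    → PowerDominating G ⟦ S ⟧
lemma5 G S i S′ S′⊆𝒫 (_ , forces) w with 𝒫? G ⟦ S ⟧ (⟦⟧? S) i w
... | yes pw = i , pw
... | no ¬pw with forces w (inj₁ ¬pw)
...   | j , qw = j + i , simulate G ⟦ S ⟧ (⟦⟧? S) i ⟦ S′ ⟧ S′⊆𝒫 j w qw
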